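{- Let $\mathcal{P}$ be a vertex selection problem that has the exchange property. For every graph $G$ and every elimination forest $F$ of $G$, the function $\omega_{\mathsf{det}}(v)\coloneqq 2^{\mathrm{lvl}_F(v)}$ isolates the family $\mathcal{P}(G)$.
   Context: A vertex selection problem maps every graph $G$ to a family $\mathcal{P}(G)\subseteq 2^{V(G)}$. In a rooted forest $F$, $\mathsf{tail}_F(u)$ is the set of strict ancestors of $u$ and $\mathrm{lvl}_F(u)=|\mathsf{tail}_F(u)|$. An elimination forest of $G$ is a rooted forest $F$ with $V(F)=V(G)$ such that for every edge $uv$, $u$ is an ancestor of $v$ or vice versa. For $A,B\subseteq V(G)$, $u$ is pivotal for $A$ and $B$ in $F$ if $u\in A\triangle B$ and $\mathsf{tail}_F(u)\cap A=\mathsf{tail}_F(u)\cap B$. For $\omega\colon V(G)\to\mathbb{N}$, $\omega(X)=\sum_{v\in X}\omega(v)$; a minimizer of $\omega$ on $\mathcal{P}(G)$ is a member of minimum weight, and $\omega$ isolates $\mathcal{P}(G)$ if there is exactly one minimizer. $\mathcal{P}$ has the exchange property if for every graph $G$, elimination forest $F$ of $G$ and $\omega\colon V(G)\to\mathbb{N}$: whenever there are two different minimizers of $\omega$ on $\mathcal{P}(G)$, there exist minimizers $A',B'$ of $\omega$ on $\mathcal{P}(G)$ with exactly one pivotal vertex in $F$. -}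

module Defs where

open import Data.Nat using (ℕ; zero; suc; _+_; _≤_; _^_)
open import Data.Bool using (Bool; true; false; if_then_else_; _∨_)
open import Data.Fin using (Fin)
open import Data.Fin.Subset using (Subset; _∩_; ∣_∣)
open import Data.Vec using (Vec; lookup; tabulate)
open import Data.List using (List; map; allFin)
open import Data.Nat.ListAction using (sum)
open import Data.Maybe using (Maybe; just; nothing; _>>=_)
open import Data.Product using (Σ; ∃; ∃-syntax; _×_; _,_)
open import Data.Empty using (⊥)
open import Relation.Nullary using (¬_; does)
open import Relation.Binary.PropositionalEquality using (_≡_; _≢_)
import Data.Fin.Properties as FinP

record Graph (n : ℕ) : Set where
  field
    adj    : Fin n → Fin n → Bool
    sym    : ∀ u v → adj u v ≡ adj v u
    irrefl : ∀ v → adj v v ≡ false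
open Graph public

VertexSelectionProblem : Set
VertexSelectionProblem = (n : ℕ) → Graph n → Subset n → Bool

-- A rooted forest on Fin n: parent pointers (nothing = root), acyclic.
record Forest (n : ℕ) : Set where
  field
    parent  : Fin n → Maybe (Fin n)
open Forest public

up : ∀ {n} → Forest n → ℕ → Fin n → Maybe (Fin n)
up F zero    v = just v
up F (suc k) v = parent F v >>= up F k

-- Acyclicity: walking up from every vertex reaches beyond a root.
IsRootedForest : ∀ {n} → Forest n → Set
IsRootedForest {n} F = ∀ v → ∃[ k ] up F k v ≡ nothing

StrictAncestor : ∀ {n} → Forest n → Fin n → Fin n → Set
StrictAncestor F u v = ∃[ k ] up F (suc k) v ≡ just u

isUp : ∀ {n} → Forest n → ℕ → Fin n → Fin n → Bool
isUp F k v w with up F k v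
... | nothing = false
... | just x  = does (x FinP.≟ w)

anyUp : ∀ {n} → Forest n → ℕ → Fin n → Fin n → Bool
anyUp F zero    v w = false
anyUp F (suc m) v w = isUp F (suc m) v w ∨ anyUp F m v w

-- tail_F(u): set of strict ancestors of u.  In a rooted forest on n
-- vertices every strict ancestor is reached within n steps.
tail : ∀ {n} → Forest n → Fin n → Subset n
tail {n} F u = tabulate (λ w → anyUp F n u w)

lvl : ∀ {n} → Forest n → Fin n → ℕ
lvl F u = ∣ tail F u ∣

IsEliminationForest : ∀ {n} → Graph n → Forest n → Set
IsEliminationForest {n} G F =
  IsRootedForest F ×
  (∀ u v → adj G u v ≡ true → StrictAncestor F u v Data.Sum.⊎ StrictAncestor F v u)
  where import Data.Sum

weight : ∀ {n} → (Fin n → ℕ) → Subset n → ℕ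
weight {n} ω X = sum (map (λ v → if lookup X v then ω v else 0) (allFin n))

IsMinimizer : VertexSelectionProblem → ∀ {n} → Graph n → (Fin n → ℕ) → Subset n → Set
IsMinimizer P {n} G ω X =
  P n G X ≡ true × (∀ Y → P n G Y ≡ true → weight ω X ≤ weight ω Y)

Isolates : VertexSelectionProblem → ∀ {n} → Graph n → (Fin n → ℕ) → Set
Isolates P G ω =
  ∃[ X ] (IsMinimizer P G ω X × (∀ Y → IsMinimizer P G ω Y → Y ≡ X))

Pivotal : ∀ {n} → Forest n → Subset n → Subset n → Fin n → Set
Pivotal F A B u = lookup A u ≢ lookup B u × (tail F u ∩ A ≡ tail F u ∩ B)

ExactlyOnePivotal : ∀ {n} → Forest n → Subset n → Subset n → Set
ExactlyOnePivotal F A B =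
  ∃[ u ] (Pivotal F A B u × (∀ w → Pivotal F A B w → w ≡ u))

HasExchangeProperty : VertexSelectionProblem → Set
HasExchangeProperty P =
  ∀ n (G : Graph n) (F : Forest n) → IsEliminationForest G F →
  (ω : Fin n → ℕ) →
  (∃[ A ] ∃[ B ] (IsMinimizer P G ω A × IsMinimizer P G ω B × A ≢ B)) →
  ∃[ A′ ] ∃[ B′ ] (IsMinimizer P G ω A′ × IsMinimizer P G ω B′ × ExactlyOnePivotal F A′ B′)

ωdet : ∀ {n} → Forest n → Fin n → ℕ
ωdet F v = 2 ^ lvl F v

-- If two minimizers existed, the exchange property would give minimizers A and B
-- with a single pivotal vertex u.  A vertex other than u at which A and B differ is
-- not pivotal, so it has a strict ancestor at which they differ as well; descending
-- through such ancestors ends at u, so every such vertex lies strictly deeper than u.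
-- Modulo 2 ^ (lvl u + 1) the ω_det-weights of A and B thus differ by 2 ^ lvl u, yet
-- two minimizers have the same weight.

module Submission where

open import Defs hiding (sym)
open import Data.Nat using (ℕ; zero; suc; _+_; _*_; _∸_; _≤_; _<_; _^_; NonZero; _%_)
open import Data.Nat.Properties
  using (≤-pred; +-suc; <-trans; ≤-<-trans; <⇒≢; ≤-antisym; _<?_; ≮⇒≥; n<1+n; m<n+m; m<m+n;
         +-monoʳ-<; +-identityʳ; *-comm; m≤m*n; m∸n≤m; ∸-monoʳ-<; m+[n∸m]≡n; m∸n+n≡m;
         ^-distribˡ-+-*; m^n≢0; m^n>0; +-commutativeSemigroup)
open import Data.Nat.Induction using (<-wellFounded)
open import Data.Nat.DivMod using (%-distribˡ-+; m<n⇒m%n≡m; [m+n]%n≡m%n; m%n<n)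
open import Data.Nat.Divisibility using (_∣_; divides; _∣0; n∣m⇒m%n≡0)
open import Data.Nat.ListAction using (sum)
open import Algebra.Properties.CommutativeSemigroup +-commutativeSemigroup using (x∙yz≈y∙xz)
open import Data.Bool using (true; false; _∧_; if_then_else_)
open import Data.Bool.Properties using (∨-zeroʳ) renaming (_≟_ to _≟ᴮ_)
open import Data.Fin using (Fin; toℕ) renaming (zero to fzero; suc to fsuc)
open import Data.Fin.Properties using (_≟_; suc-injective; pigeonhole; ¬∀⟶∃¬; toℕ<n)
open import Data.Fin.Subset using (Subset; _∩_; _⊂_; _∈_)
open import Data.Fin.Subset.Properties using (p⊂q⇒∣p∣<∣q∣; anySubset?)
open import Data.Vec using (Vec; lookup; tabulate)
open import Data.Vec.Properties using ([]=↔lookup; lookup∘tabulate; lookup-zipWith; tabulate∘lookup; tabulate-cong; ≡-dec)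
import Data.List as List
open import Data.List.Properties using (map-tabulate)
open import Data.Maybe using (Maybe; just; nothing; _>>=_; fromMaybe)
open import Data.Product using (∃-syntax; _×_; _,_; proj₁)
open import Data.Empty using (⊥; ⊥-elim)
open import Function using (case_of_; _∘_)
open import Function.Bundles using (Inverse)
open import Induction.WellFounded using (Acc; acc)
open import Relation.Nullary using (¬_; yes; no)
open import Relation.Nullary.Decidable using (dec-true; _×-dec_)
open import Relation.Binary.PropositionalEquality
open ≡-Reasoning


module _ {n} (F : Forest n) where

  up-+ : ∀ a b v → up F (a + b) v ≡ (up F a v >>= up F b)
  up-+ zero    b v = refl
  up-+ (suc a) b v with parent F v
  ... | nothing = refl
  ... | just p  = up-+ a b p

  up-nothing-mono : ∀ {k m v} → up F k v ≡ nothing → k ≤ m → up F m v ≡ nothing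
  up-nothing-mono {k} {m} {v} e k≤m = begin
    up F m v                    ≡⟨ cong (λ i → up F i v) (sym (m+[n∸m]≡n k≤m)) ⟩
    up F (k + (m ∸ k)) v        ≡⟨ up-+ k (m ∸ k) v ⟩
    (up F k v >>= up F (m ∸ k)) ≡⟨ cong (_>>= up F (m ∸ k)) e ⟩
    nothing                     ∎

  up-cycle : ∀ {d y} → up F (suc d) y ≡ just y → ∀ m → up F (m * suc d) y ≡ just y
  up-cycle         e zero    = refl
  up-cycle {d} {y} e (suc m) = begin
    up F (suc d + m * suc d) y               ≡⟨ up-+ (suc d) (m * suc d) y ⟩
    (up F (suc d) y >>= up F (m * suc d))   ≡⟨ cong (_>>= up F (m * suc d)) e ⟩
    up F (m * suc d) y                       ≡⟨ up-cycle e m ⟩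
    just y                                   ∎

  strictAncestor-trans : ∀ {x y w} → StrictAncestor F x w → StrictAncestor F y x → StrictAncestor F y w
  strictAncestor-trans {x} {y} {w} (k , ek) (j , ej) = k + suc j , (begin
    up F (suc k + suc j) w                 ≡⟨ up-+ (suc k) (suc j) w ⟩
    (up F (suc k) w >>= up F (suc j))     ≡⟨ cong (_>>= up F (suc j)) ek ⟩
    up F (suc j) x                         ≡⟨ ej ⟩
    just y                                 ∎)

  isUp⇒up : ∀ k v x → isUp F k v x ≡ true → up F k v ≡ just x
  isUp⇒up k v x e with up F k v
  isUp⇒up k v x () | nothing
  ... | just z with z ≟ x
  ...   | yes z≡x = cong just z≡x
  isUp⇒up k v x () | just z | no _

  up⇒isUp : ∀ k v x → up F k v ≡ just x → isUp F k v x ≡ true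
  up⇒isUp k v x e with up F k v
  up⇒isUp k v x refl | just .x = dec-true (x ≟ x) refl

  anyUp⇒up : ∀ m v x → anyUp F m v x ≡ true → ∃[ k ] k < m × up F (suc k) v ≡ just x
  anyUp⇒up (suc m) v x e with isUp F (suc m) v x in eq
  ... | true  = m , n<1+n m , isUp⇒up (suc m) v x eq
  ... | false with anyUp⇒up m v x e
  ...   | k , k<m , ek = k , <-trans k<m (n<1+n m) , ek

  up⇒anyUp : ∀ m k v x → k < m → up F (suc k) v ≡ just x → anyUp F m v x ≡ true
  up⇒anyUp (suc m) k v x k<1+m e with k <? m
  ... | yes k<m rewrite up⇒anyUp m k v x k<m e = ∨-zeroʳ (isUp F (suc m) v x)
  ... | no k≮m with ≤-antisym (≮⇒≥ k≮m) (≤-pred k<1+m)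
  ...   | refl rewrite up⇒isUp (suc k) v x e = refl


  ∈-tail⁻ : ∀ {x v} → x ∈ tail F v → StrictAncestor F x v
  ∈-tail⁻ {x} {v} x∈ with anyUp⇒up n v x (trans (sym (lookup∘tabulate _ x)) (Inverse.to []=↔lookup x∈))
  ... | k , _ , ek = k , ek


just≡fromMaybe : ∀ {A : Set} {m : Maybe A} (d : A) → m ≢ nothing → m ≡ just (fromMaybe d m)
just≡fromMaybe {m = nothing} d m≢nothing = ⊥-elim (m≢nothing refl)
just≡fromMaybe {m = just x}  d _         = refl

module Rooted {n} {F : Forest n} (rooted : IsRootedForest F) where

  up-acyclic : ∀ d y → up F (suc d) y ≢ just y
  up-acyclic d y e with rooted y
  ... | K , eK with trans (sym (up-cycle F e K)) (up-nothing-mono F eK (m≤m*n K (suc d)))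
  ... | ()

  strictAncestor-irrefl : ∀ {x} → ¬ StrictAncestor F x x
  strictAncestor-irrefl {x} (k , e) = up-acyclic k x e

  ancestor : Fin n → ℕ → Fin n
  ancestor w k = fromMaybe w (up F k w)

  -- Among the n + 1 ancestors at depths 0, …, n two would coincide, closing a cycle.
  up-n-undefined : ∀ w → up F n w ≢ nothing → ⊥
  up-n-undefined w defined with pigeonhole (n<1+n n) (λ i → ancestor w (toℕ i))
  ... | i , j , i<j , same = up-acyclic d (ancestor w a) (begin
      up F (suc d) (ancestor w a)               ≡⟨ cong (_>>= up F (suc d)) (up-ancestor a (≤-pred (toℕ<n i))) ⟨
      (up F a w >>= up F (suc d))               ≡⟨ up-+ F a (suc d) w ⟨
      up F (a + suc d) w                        ≡⟨ cong (λ k → up F k w) (trans (+-suc a d) (m+[n∸m]≡n i<j)) ⟩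
      up F (toℕ j) w                            ≡⟨ up-ancestor (toℕ j) (≤-pred (toℕ<n j)) ⟩
      just (ancestor w (toℕ j))                 ≡⟨ cong just same ⟨
      just (ancestor w a)                       ∎)
    where
      a = toℕ i
      d = toℕ j ∸ suc a

      up-ancestor : ∀ k → k ≤ n → up F k w ≡ just (ancestor w k)
      up-ancestor k k≤n = just≡fromMaybe w (λ e → defined (up-nothing-mono F e k≤n))

  up-n≡nothing : ∀ w → up F n w ≡ nothing
  up-n≡nothing w with up F n w in eq
  ... | nothing = refl
  ... | just _  = ⊥-elim (up-n-undefined w (λ e → case trans (sym eq) e of λ ()))

  up-depth-< : ∀ {m w y} → up F m w ≡ just y → m < n
  up-depth-< {m} {w} e with m <? n
  ... | yes m<n = m<n
  ... | no  m≮n = case trans (sym e) (up-nothing-mono F (up-n≡nothing w) (≮⇒≥ m≮n)) of λ ()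

  ∈-tail⁺ : ∀ {x v} → StrictAncestor F x v → x ∈ tail F v
  ∈-tail⁺ {x} {v} (k , ek) = Inverse.from []=↔lookup (begin
    lookup (tail F v) x ≡⟨ lookup∘tabulate _ x ⟩
    anyUp F n v x       ≡⟨ up⇒anyUp F n k v x (<-trans (n<1+n k) (up-depth-< ek)) ek ⟩
    true                ∎)

  tail-⊂ : ∀ {x w} → StrictAncestor F x w → tail F x ⊂ tail F w
  tail-⊂ x<w =
    (λ y∈ → ∈-tail⁺ (strictAncestor-trans F x<w (∈-tail⁻ F y∈))) ,
    _ , ∈-tail⁺ x<w , λ x∈ → strictAncestor-irrefl (∈-tail⁻ F x∈)

  lvl-< : ∀ {x w} → StrictAncestor F x w → lvl F x < lvl F w
  lvl-< x<w = p⊂q⇒∣p∣<∣q∣ (tail-⊂ x<w)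


lookup-ext : ∀ {A : Set} {m} {xs ys : Vec A m} → (∀ i → lookup xs i ≡ lookup ys i) → xs ≡ ys
lookup-ext {xs = xs} {ys} eq = begin
  xs                  ≡⟨ tabulate∘lookup xs ⟨
  tabulate (lookup xs) ≡⟨ tabulate-cong eq ⟩
  tabulate (lookup ys) ≡⟨ tabulate∘lookup ys ⟩
  ys                  ∎

∧-≢ : ∀ t a b → t ∧ a ≢ t ∧ b → t ≡ true × a ≢ b
∧-≢ false a b ne = ⊥-elim (ne refl)
∧-≢ true  a b ne = refl , ne

differing-strictAncestor : ∀ {n} (F : Forest n) (A B : Subset n) {w} →
  lookup A w ≢ lookup B w → ¬ Pivotal F A B w →
  ∃[ x ] StrictAncestor F x w × lookup A x ≢ lookup B x
differing-strictAncestor {n} F A B {w} dw ¬piv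
  with ¬∀⟶∃¬ n (λ i → lookup (tail F w ∩ A) i ≡ lookup (tail F w ∩ B) i) (λ i → _ ≟ᴮ _)
             (λ agree → ¬piv (dw , lookup-ext agree))
... | x , differ with ∧-≢ (lookup (tail F w) x) (lookup A x) (lookup B x) (λ e →
                   differ (trans (lookup-zipWith _∧_ x (tail F w) A)
                           (trans e (sym (lookup-zipWith _∧_ x (tail F w) B)))))
...   | x∈tail , dx = x , ∈-tail⁻ F (Inverse.from []=↔lookup x∈tail) , dx

module _ {n} {F : Forest n} (rooted : IsRootedForest F) {A B : Subset n} {u : Fin n}
         (unique : ∀ w → Pivotal F A B w → w ≡ u) where
  open Rooted rooted

  unique-pivot-lowest : ∀ v → v ≢ u → lookup A v ≢ lookup B v → lvl F u < lvl F v
  unique-pivot-lowest v = go v (<-wellFounded (lvl F v))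
    where
      go : ∀ v → Acc _<_ (lvl F v) → v ≢ u → lookup A v ≢ lookup B v → lvl F u < lvl F v
      go v (acc below) v≢u dv
        with differing-strictAncestor F A B dv (λ piv → v≢u (unique v piv))
      ... | x , x<v , dx with x ≟ u
      ...   | yes refl = lvl-< x<v
      ...   | no  x≢u  = <-trans (go x (below (lvl-< x<v)) x≢u dx) (lvl-< x<v)


∑ : ∀ {n} → (Fin n → ℕ) → ℕ
∑ f = sum (List.tabulate f)

module Modulo (M : ℕ) .{{_ : NonZero M}} where

  +-cong-% : ∀ {a b c d} → a % M ≡ b % M → c % M ≡ d % M → (a + c) % M ≡ (b + d) % M
  +-cong-% {a} {b} {c} {d} a≡b c≡d = begin
    (a + c) % M               ≡⟨ %-distribˡ-+ a c M ⟩
    (a % M + c % M) % M       ≡⟨ cong₂ (λ x y → (x + y) % M) a≡b c≡d ⟩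
    (b % M + d % M) % M       ≡⟨ %-distribˡ-+ b d M ⟨
    (b + d) % M               ∎

  ∑-cong-% : ∀ {n} {f g : Fin n → ℕ} → (∀ i → f i % M ≡ g i % M) → ∑ f % M ≡ ∑ g % M
  ∑-cong-% {zero}  eq = refl
  ∑-cong-% {suc n} eq = +-cong-% (eq fzero) (∑-cong-% (λ i → eq (fsuc i)))

  ∑-cong-%-except : ∀ {n} {f g : Fin n → ℕ} u → (∀ i → i ≢ u → f i % M ≡ g i % M) →
                    (g u + ∑ f) % M ≡ (f u + ∑ g) % M
  ∑-cong-%-except {suc n} {f} {g} fzero eq = begin
    (g fzero + (f fzero + ∑ f′)) % M   ≡⟨ cong (_% M) (x∙yz≈y∙xz (g fzero) (f fzero) (∑ f′)) ⟩
    (f fzero + (g fzero + ∑ f′)) % M   ≡⟨ +-cong-% {f fzero} refl (+-cong-% {g fzero} refl (∑-cong-% (λ i → eq (fsuc i) λ ()))) ⟩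
    (f fzero + (g fzero + ∑ g′)) % M   ∎
    where f′ = λ i → f (fsuc i); g′ = λ i → g (fsuc i)
  ∑-cong-%-except {suc n} {f} {g} (fsuc u) eq = begin
    (g (fsuc u) + (f fzero + ∑ f′)) % M   ≡⟨ cong (_% M) (x∙yz≈y∙xz (g (fsuc u)) (f fzero) (∑ f′)) ⟩
    (f fzero + (g (fsuc u) + ∑ f′)) % M   ≡⟨ +-cong-% (eq fzero λ ()) (∑-cong-%-except u (λ i i≢u → eq (fsuc i) (i≢u ∘ suc-injective))) ⟩
    (g fzero + (f (fsuc u) + ∑ g′)) % M   ≡⟨ cong (_% M) (x∙yz≈y∙xz (g fzero) (f (fsuc u)) (∑ g′)) ⟩
    (f (fsuc u) + (g fzero + ∑ g′)) % M   ∎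
    where f′ = λ i → f (fsuc i); g′ = λ i → g (fsuc i)


^-monoʳ-∣ : ∀ b {m k} → m ≤ k → b ^ m ∣ b ^ k
^-monoʳ-∣ b {m} {k} m≤k = divides (b ^ (k ∸ m)) (begin
  b ^ k                 ≡⟨ cong (b ^_) (m+[n∸m]≡n m≤k) ⟨
  b ^ (m + (k ∸ m))     ≡⟨ ^-distribˡ-+-* b m (k ∸ m) ⟩
  b ^ m * b ^ (k ∸ m)   ≡⟨ *-comm (b ^ m) _ ⟩
  b ^ (k ∸ m) * b ^ m   ∎)

[P+m]%M≢m%M : ∀ m {P M} .{{_ : NonZero M}} → 0 < P → M ≡ P + P → (P + m) % M ≢ m % M
[P+m]%M≢m%M m {P} {M} P>0 M≡P+P eq = case r <? P of λ where
    (yes r<P) → <⇒≢ (m<n+m r P>0) (sym (begin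
      P + r                 ≡⟨ m<n⇒m%n≡m (subst (P + r <_) (sym M≡P+P) (+-monoʳ-< P r<P)) ⟨
      (P + r) % M           ≡⟨ shift ⟩
      r                     ∎))
    (no r≮P) → let P≤r = ≮⇒≥ r≮P in <⇒≢ (∸-monoʳ-< P>0 P≤r) (begin
      r ∸ P                 ≡⟨ m<n⇒m%n≡m (≤-<-trans (m∸n≤m r P) (m%n<n m M)) ⟨
      (r ∸ P) % M           ≡⟨ [m+n]%n≡m%n (r ∸ P) M ⟨
      (r ∸ P + M) % M       ≡⟨ cong (_% M) (trans (cong (r ∸ P +_) M≡P+P) (sym (x∙yz≈y∙xz P (r ∸ P) P))) ⟩
      (P + (r ∸ P + P)) % M ≡⟨ cong (λ x → (P + x) % M) (m∸n+n≡m P≤r) ⟩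
      (P + r) % M           ≡⟨ shift ⟩
      r                     ∎)
  where
    r = m % M
    shift : (P + r) % M ≡ r
    shift = begin
      (P + r) % M         ≡⟨ cong (λ x → (x + r) % M) (m<n⇒m%n≡m (subst (P <_) (sym M≡P+P) (m<m+n P P>0))) ⟨
      (P % M + r) % M     ≡⟨ %-distribˡ-+ P m M ⟨
      (P + m) % M         ≡⟨ eq ⟩
      r                   ∎

weight≡∑ : ∀ {n} (ω : Fin n → ℕ) X → weight ω X ≡ ∑ (λ v → if lookup X v then ω v else 0)
weight≡∑ ω X = cong sum (map-tabulate (λ v → v) (λ v → if lookup X v then ω v else 0))

2^-weight-≢ : ∀ {n} (ℓ : Fin n → ℕ) {A B : Subset n} u →
  lookup A u ≡ true → lookup B u ≡ false →
  (∀ v → v ≢ u → lookup A v ≢ lookup B v → ℓ u < ℓ v) →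
  weight (λ v → 2 ^ ℓ v) A ≢ weight (λ v → 2 ^ ℓ v) B
2^-weight-≢ ℓ {A} {B} u A∋u B∌u lowest weq =
  [P+m]%M≢m%M (∑ (term B)) (m^n>0 2 (ℓ u)) (cong (P +_) (+-identityʳ P)) (begin
    (P + ∑ (term B)) % M            ≡⟨ cong (λ b → ((if b then P else 0) + ∑ (term B)) % M) A∋u ⟨
    (term A u + ∑ (term B)) % M     ≡⟨ ∑-cong-%-except u agree ⟨
    (term B u + ∑ (term A)) % M     ≡⟨ cong (λ b → ((if b then P else 0) + ∑ (term A)) % M) B∌u ⟩
    ∑ (term A) % M                  ≡⟨ cong (_% M) (trans (sym (weight≡∑ _ A)) (trans weq (weight≡∑ _ B))) ⟩
    ∑ (term B) % M                  ∎)
  where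
    P = 2 ^ ℓ u
    M = 2 ^ suc (ℓ u)
    instance
      M-nonZero : NonZero M
      M-nonZero = m^n≢0 2 (suc (ℓ u))
    open Modulo M

    term : Subset _ → Fin _ → ℕ
    term X v = if lookup X v then 2 ^ ℓ v else 0

    term-%-≡0 : ∀ b {v} → ℓ u < ℓ v → (if b then 2 ^ ℓ v else 0) % M ≡ 0
    term-%-≡0 true  u<v = n∣m⇒m%n≡0 _ M (^-monoʳ-∣ 2 u<v)
    term-%-≡0 false _   = n∣m⇒m%n≡0 0 M (M ∣0)

    agree : ∀ v → v ≢ u → term A v % M ≡ term B v % M
    agree v v≢u with lookup A v ≟ᴮ lookup B v
    ... | yes same = cong (λ b → (if b then 2 ^ ℓ v else 0) % M) same
    ... | no  diff = trans (term-%-≡0 (lookup A v) u<v) (sym (term-%-≡0 (lookup B v) u<v))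
      where u<v = lowest v v≢u diff


exactlyOnePivotal⇒ωdet-weight-≢ : ∀ {n} {F : Forest n} → IsRootedForest F → ∀ {A B} →
  ExactlyOnePivotal F A B → weight (ωdet F) A ≢ weight (ωdet F) B
exactlyOnePivotal⇒ωdet-weight-≢ {F = F} rooted {A} {B} (u , (A≢B-at-u , _) , unique)
  with lookup A u in A-u | lookup B u in B-u
... | true  | true  = ⊥-elim (A≢B-at-u refl)
... | false | false = ⊥-elim (A≢B-at-u refl)
... | true  | false = 2^-weight-≢ (lvl F) {A} {B} u A-u B-u (unique-pivot-lowest rooted unique)
... | false | true  = ≢-sym (2^-weight-≢ (lvl F) {B} {A} u B-u A-u λ v v≢u diff →
                        unique-pivot-lowest rooted unique v v≢u (≢-sym diff))

module _ (P : VertexSelectionProblem) {n} {G : Graph n} {ω : Fin n → ℕ} where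

  minimizer-exists : ∀ X → P n G X ≡ true → ∃[ Y ] IsMinimizer P G ω Y
  minimizer-exists X X∈P = go X (<-wellFounded (weight ω X)) X∈P
    where
      go : ∀ X → Acc _<_ (weight ω X) → P n G X ≡ true → ∃[ Y ] IsMinimizer P G ω Y
      go X (acc below) X∈P
        with anySubset? (λ Y → (P n G Y ≟ᴮ true) ×-dec (weight ω Y <? weight ω X))
      ... | yes (Y , Y∈P , Y<X) = go Y (below Y<X) Y∈P
      ... | no  ¬lighter        = X , X∈P , λ Y Y∈P → ≮⇒≥ (λ Y<X → ¬lighter (Y , Y∈P , Y<X))

  minimizers-same-weight : ∀ {A B} → IsMinimizer P G ω A → IsMinimizer P G ω B → weight ω A ≡ weight ω B
  minimizers-same-weight (A∈P , A-min) (B∈P , B-min) = ≤-antisym (A-min _ B∈P) (B-min _ A∈P)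

lemma8p2 : (P : VertexSelectionProblem) → HasExchangeProperty P →
           ∀ n (G : Graph n) (F : Forest n) → IsEliminationForest G F →
           (∃[ X ] P n G X ≡ true) →
           Isolates P G (ωdet F)
lemma8p2 P exchange n G F elim (X , X∈P) with minimizer-exists P X X∈P
... | X₀ , X₀-min = X₀ , X₀-min , unique
  where
    unique : ∀ Y → IsMinimizer P G (ωdet F) Y → Y ≡ X₀
    unique Y Y-min with ≡-dec _≟ᴮ_ Y X₀
    ... | yes Y≡X₀ = Y≡X₀
    ... | no  Y≢X₀ with exchange n G F elim (ωdet F) (Y , X₀ , Y-min , X₀-min , Y≢X₀)
    ...   | A′ , B′ , A′-min , B′-min , one-pivot =
      ⊥-elim (exactlyOnePivotal⇒ωdet-weight-≢ (proj₁ elim) one-pivot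
               (minimizers-same-weight P A′-min B′-min))
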